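{- Let $n\ge0$, let $a+bi\in\mathbb{Z}[i]\setminus(1+i)\mathbb{Z}[i]$ and let $u\in\{\pm1,\pm i\}$. If $x+yi\in Oct_n+u(a+bi)$ and $2\mid(x+y)$, then $x+yi\in B_n+u(a+bi)$.
   Context: For $k\ge0$, $w_{2k}=3\cdot2^k$, $w_{2k+1}=4\cdot2^k$. $Oct_n=\{x+yi\in\mathbb{Z}[i]: |x|,|y|\le w_n-2,\ |x|+|y|\le w_{n+1}-3\}$. $B_n=\{\sum_{j=0}^n v_j(1+i)^j: v_j\in\{0,\pm1,\pm i\}\}$. -}

module Defs where

open import Data.Nat using (ℕ; zero; suc)
open import Data.Integer using (ℤ; +_; _+_; _-_; _*_; -_; ∣_∣; _≤_)
open import Data.Integer.Divisibility using (_∣_)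
open import Data.Product using (_×_; _,_; Σ; ∃)
open import Data.Fin using (Fin; zero; suc)
open import Relation.Binary.PropositionalEquality using (_≡_)
open import Relation.Nullary using (¬_)

ℤ[i] : Set
ℤ[i] = ℤ × ℤ

re : ℤ[i] → ℤ
re (x , _) = x

im : ℤ[i] → ℤ
im (_ , y) = y

infixl 6 _+ᵍ_
infixl 7 _*ᵍ_

_+ᵍ_ : ℤ[i] → ℤ[i] → ℤ[i]
(a , b) +ᵍ (c , d) = (a + c , b + d)

_*ᵍ_ : ℤ[i] → ℤ[i] → ℤ[i]
(a , b) *ᵍ (c , d) = (a * c - b * d , a * d + b * c)

0ᵍ : ℤ[i]
0ᵍ = (+ 0 , + 0)

1ᵍ : ℤ[i]
1ᵍ = (+ 1 , + 0)

ρ : ℤ[i]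
ρ = (+ 1 , + 1)

ρ^ : ℕ → ℤ[i]
ρ^ zero = 1ᵍ
ρ^ (suc j) = ρ *ᵍ ρ^ j

data Unit : Set where
  one negone eye negeye : Unit

unitVal : Unit → ℤ[i]
unitVal one    = (+ 1 , + 0)
unitVal negone = (- + 1 , + 0)
unitVal eye    = (+ 0 , + 1)
unitVal negeye = (+ 0 , - + 1)

data Digit : Set where
  dzero : Digit
  dunit : Unit → Digit

digitVal : Digit → ℤ[i]
digitVal dzero     = 0ᵍ
digitVal (dunit u) = unitVal u

-- w_{2k} = 3·2^k, w_{2k+1} = 4·2^k
w : ℕ → ℕ
w zero = 3
w (suc zero) = 4
w (suc (suc n)) = 2 Data.Nat.* w n

Oct : ℕ → ℤ[i] → Set
Oct n (x , y) =
  (+ ∣ x ∣ ≤ + w n - + 2) × (+ ∣ y ∣ ≤ + w n - + 2)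
  × (+ ∣ x ∣ + + ∣ y ∣ ≤ + w (suc n) - + 3)

digitSum : (m : ℕ) → (Fin (suc m) → Digit) → ℤ[i]
digitSum zero v = digitVal (v zero)
digitSum (suc m) v = digitSum m (λ j → v (Data.Fin.inject₁ j)) +ᵍ digitVal (v (Data.Fin.fromℕ (suc m))) *ᵍ ρ^ (suc m)

B : ℕ → ℤ[i] → Set
B n z = Σ (Fin (suc n) → Digit) λ v → digitSum n v ≡ z

_∈_+ₛ_ : ℤ[i] → (ℤ[i] → Set) → ℤ[i] → Set
z ∈ S +ₛ c = Σ ℤ[i] λ s → S s × (z ≡ s +ᵍ c)

_∣ᵍ_ : ℤ[i] → ℤ[i] → Set
d ∣ᵍ z = Σ ℤ[i] λ q → z ≡ d *ᵍ q

-- The points of Oct 0 with odd coordinate sum are the four units, i.e. B 0.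
-- A point z of Oct (n+1) with odd coordinate sum has one odd and one even coordinate.
-- Subtracting the unit that moves the even coordinate one step towards 0 leaves a point
-- with even coordinate sum, i.e. a multiple ρ t of ρ = 1 + i; the coordinates of ρ t are
-- the diagonals t₁ - t₂ and t₁ + t₂ of t, both odd. The untouched odd coordinate cannot
-- reach the even bound w (n+1) - 2, and the nudged one has lost 1 in absolute value (or
-- become -1), which is exactly what the bounds of Oct n demand of the diagonals. So
-- t ∈ Oct n has odd coordinate sum, and z = u + ρ t ∈ B (n+1). For the theorem,
-- (1+i) ∤ a+bi means that a + b is odd, so the translation by u(a+bi) changes the parity
-- of the coordinate sum.
module Submission where

open import Defs
open import Data.Nat using (ℕ)
open import Data.Integer using (ℤ; _+_)
open import Data.Integer.Divisibility using (_∣_)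
open import Data.Product using (_,_)
open import Relation.Nullary using (¬_)

open import Data.Nat as ℕ using (zero; suc; s≤s)
import Data.Nat.Properties as ℕ
import Data.Nat.Divisibility as ℕᵈ
open import Data.Integer using (+_; -[1+_]; -_; _-_; _*_; ∣_∣; _≤_; +≤+; sign; _◃_; _%ℕ_; _/ℕ_)
import Data.Integer.Properties as ℤ
open import Data.Integer.DivMod using (n%ℕd<d; a≡a%ℕn+[a/ℕn]*n)
import Data.Integer.Divisibility.Signed as Signed
open import Data.Integer.Tactic.RingSolver using (solve-∀)
open import Data.Sign.Base using (Sign)
open import Data.Fin using (zero; suc; inject₁; fromℕ)
open import Data.Vec.Functional using (Vector; _∷_; init)
open import Data.Product using (_×_)
open import Data.Sum using (_⊎_; inj₁; inj₂)
open import Function using (_∘_)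
open import Relation.Nullary using (yes; no; contradiction)
open import Relation.Binary.PropositionalEquality

+ᵍ-assoc : ∀ x y z → (x +ᵍ y) +ᵍ z ≡ x +ᵍ (y +ᵍ z)
+ᵍ-assoc (a , b) (c , d) (e , f) = cong₂ _,_ (ℤ.+-assoc a c e) (ℤ.+-assoc b d f)

*ᵍ-identityʳ : ∀ x → x *ᵍ 1ᵍ ≡ x
*ᵍ-identityʳ (a , b) = cong₂ _,_ (re-law a b) (im-law a b)
  where
  re-law : ∀ a b → a * + 1 - b * + 0 ≡ a
  re-law = solve-∀
  im-law : ∀ a b → a * + 0 + b * + 1 ≡ b
  im-law = solve-∀

*ᵍ-comm : ∀ x y → x *ᵍ y ≡ y *ᵍ x
*ᵍ-comm (a , b) (c , d) = cong₂ _,_ (re-law a b c d) (im-law a b c d)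
  where
  re-law : ∀ a b c d → a * c - b * d ≡ c * a - d * b
  re-law = solve-∀
  im-law : ∀ a b c d → a * d + b * c ≡ c * b + d * a
  im-law = solve-∀

*ᵍ-assoc : ∀ x y z → (x *ᵍ y) *ᵍ z ≡ x *ᵍ (y *ᵍ z)
*ᵍ-assoc (a , b) (c , d) (e , f) = cong₂ _,_ (re-law a b c d e f) (im-law a b c d e f)
  where
  re-law : ∀ a b c d e f →
    (a * c - b * d) * e - (a * d + b * c) * f ≡ a * (c * e - d * f) - b * (c * f + d * e)
  re-law = solve-∀
  im-law : ∀ a b c d e f →
    (a * c - b * d) * f + (a * d + b * c) * e ≡ a * (c * f + d * e) + b * (c * e - d * f)
  im-law = solve-∀

*ᵍ-distribˡ-+ᵍ : ∀ x y z → x *ᵍ (y +ᵍ z) ≡ x *ᵍ y +ᵍ x *ᵍ z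
*ᵍ-distribˡ-+ᵍ (a , b) (c , d) (e , f) = cong₂ _,_ (re-law a b c d e f) (im-law a b c d e f)
  where
  re-law : ∀ a b c d e f → a * (c + e) - b * (d + f) ≡ (a * c - b * d) + (a * e - b * f)
  re-law = solve-∀
  im-law : ∀ a b c d e f → a * (d + f) + b * (c + e) ≡ (a * d + b * c) + (a * f + b * e)
  im-law = solve-∀

digitSum-cong : ∀ m {v v′ : Vector Digit (suc m)} → v ≗ v′ → digitSum m v ≡ digitSum m v′
digitSum-cong zero    eq = cong digitVal (eq zero)
digitSum-cong (suc m) eq =
  cong₂ (λ s d → s +ᵍ digitVal d *ᵍ ρ^ (suc m)) (digitSum-cong m (eq ∘ inject₁)) (eq (fromℕ (suc m)))

init-∷ : ∀ {m} (d : Digit) (v : Vector Digit (suc m)) → init (d ∷ v) ≗ d ∷ init v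
init-∷ d v zero    = refl
init-∷ d v (suc j) = refl

digitSum-∷ : ∀ m d (v : Vector Digit (suc m)) → digitSum (suc m) (d ∷ v) ≡ digitVal d +ᵍ ρ *ᵍ digitSum m v
digitSum-∷ zero d v =
  cong (digitVal d +ᵍ_) (trans (cong (digitVal (v zero) *ᵍ_) (*ᵍ-identityʳ ρ)) (*ᵍ-comm (digitVal (v zero)) ρ))
digitSum-∷ (suc m) d v = begin
  digitSum (suc m) (init (d ∷ v)) +ᵍ e *ᵍ (ρ *ᵍ r) ≡⟨ cong (_+ᵍ e *ᵍ (ρ *ᵍ r)) (digitSum-cong (suc m) (init-∷ d v)) ⟩
  digitSum (suc m) (d ∷ init v) +ᵍ e *ᵍ (ρ *ᵍ r)   ≡⟨ cong (_+ᵍ e *ᵍ (ρ *ᵍ r)) (digitSum-∷ m d (init v)) ⟩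
  (digitVal d +ᵍ ρ *ᵍ s) +ᵍ e *ᵍ (ρ *ᵍ r)          ≡⟨ +ᵍ-assoc (digitVal d) (ρ *ᵍ s) (e *ᵍ (ρ *ᵍ r)) ⟩
  digitVal d +ᵍ (ρ *ᵍ s +ᵍ e *ᵍ (ρ *ᵍ r))          ≡⟨ cong (λ x → digitVal d +ᵍ (ρ *ᵍ s +ᵍ x)) ρ-left-comm ⟩
  digitVal d +ᵍ (ρ *ᵍ s +ᵍ ρ *ᵍ (e *ᵍ r))          ≡⟨ cong (digitVal d +ᵍ_) (*ᵍ-distribˡ-+ᵍ ρ s (e *ᵍ r)) ⟨
  digitVal d +ᵍ ρ *ᵍ (s +ᵍ e *ᵍ r)                 ∎
  where
  open ≡-Reasoning
  e r s : ℤ[i]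
  e = digitVal (v (fromℕ (suc m)))
  r = ρ^ (suc m)
  s = digitSum m (init v)
  ρ-left-comm : e *ᵍ (ρ *ᵍ r) ≡ ρ *ᵍ (e *ᵍ r)
  ρ-left-comm = trans (sym (*ᵍ-assoc e ρ r)) (trans (cong (_*ᵍ r) (*ᵍ-comm e ρ)) (*ᵍ-assoc ρ e r))

B-suc : ∀ m d {t} → B m t → B (suc m) (digitVal d +ᵍ ρ *ᵍ t)
B-suc m d (v , refl) = d ∷ v , digitSum-∷ m d v

unit∈B₀ : ∀ u → B 0 (unitVal u)
unit∈B₀ u = (λ _ → dunit u) , refl

Even Odd : ℤ → Set
Even i = + 2 Signed.∣ i
Odd i = ¬ Even i

coordSum : ℤ[i] → ℤ
coordSum (x , y) = x + y

coordSum-+ᵍ : ∀ z z′ → coordSum (z +ᵍ z′) ≡ coordSum z + coordSum z′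
coordSum-+ᵍ (a , b) (c , d) = interchange a b c d
  where
  interchange : ∀ a b c d → (a + c) + (b + d) ≡ (a + b) + (c + d)
  interchange = solve-∀

odd[s◃1] : ∀ s → Odd (s ◃ 1)
odd[s◃1] s even with ℕᵈ.∣1⇒≡1 (subst (2 ℕᵈ.∣_) (ℤ.abs-◃ s 1) (Signed.∣⇒∣ᵤ even))
... | ()

odd⇒even[i-s◃1] : ∀ s {i} → Odd i → Even (i - (s ◃ 1))
odd⇒even[i-s◃1] s {i} odd with i %ℕ 2 | n%ℕd<d i 2 | a≡a%ℕn+[a/ℕn]*n i 2
... | 0           | _             | i≡ = contradiction (Signed.divides (i /ℕ 2) (trans i≡ (ℤ.+-identityˡ _))) odd
... | suc (suc _) | s≤s (s≤s ()) | _
... | 1           | _             | i≡ with s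
...   | Sign.+ = Signed.divides (i /ℕ 2) (trans (cong (_- + 1) i≡) (minus-one (i /ℕ 2)))
  where
  minus-one : ∀ q → + 1 + q * + 2 - + 1 ≡ q * + 2
  minus-one = solve-∀
...   | Sign.- = Signed.divides (i /ℕ 2 + + 1) (trans (cong (_+ + 1) i≡) (plus-one (i /ℕ 2)))
  where
  plus-one : ∀ q → + 1 + q * + 2 + + 1 ≡ (q + + 1) * + 2
  plus-one = solve-∀

odd+odd⇒even : ∀ {i j} → Odd i → Odd j → Even (i + j)
odd+odd⇒even {i} {j} odd-i odd-j =
  subst Even (regroup i j) (Signed.∣m∣n⇒∣m+n (odd⇒even[i-s◃1] Sign.+ odd-i) (odd⇒even[i-s◃1] Sign.- odd-j))
  where
  regroup : ∀ i j → i - + 1 + (j - - + 1) ≡ i + j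
  regroup = solve-∀

even-odd⇒odd : ∀ {i j} → Even i → Odd j → Odd (i - j)
even-odd⇒odd {i} {j} even-i odd-j even-i-j = odd-j (subst Even (cancel i j) (Signed.∣m∣n⇒∣m-n even-i even-i-j))
  where
  cancel : ∀ i j → i - (i - j) ≡ j
  cancel = solve-∀

even-coordSum⇒ρ∣ᵍ : ∀ {a b} → Even (a + b) → ρ ∣ᵍ (a , b)
even-coordSum⇒ρ∣ᵍ {a} {b} (Signed.divides k a+b≡k*2) = (k , k - a) , cong₂ _,_ (re-law a k) im-eq
  where
  re-law : ∀ a k → a ≡ + 1 * k - + 1 * (k - a)
  re-law = solve-∀
  b-as-difference : ∀ a b → b ≡ a + b - a
  b-as-difference = solve-∀
  im-law : ∀ a k → k * + 2 - a ≡ + 1 * (k - a) + + 1 * k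
  im-law = solve-∀
  im-eq : b ≡ + 1 * (k - a) + + 1 * k
  im-eq = trans (b-as-difference a b) (trans (cong (_- a) a+b≡k*2) (im-law a k))

even-coordSum-unit* : ∀ u a b → Even (coordSum (unitVal u *ᵍ (a , b))) → Even (a + b)
even-coordSum-unit* one a b even = subst Even (same a b) even
  where
  same : ∀ a b → (+ 1 * a - + 0 * b) + (+ 1 * b + + 0 * a) ≡ a + b
  same = solve-∀
even-coordSum-unit* negone a b even = subst Even (negated a b) (Signed.∣m⇒∣-m even)
  where
  negated : ∀ a b → - ((- + 1 * a - + 0 * b) + (- + 1 * b + + 0 * a)) ≡ a + b
  negated = solve-∀
even-coordSum-unit* eye a b even = subst Even (shifted a b) (Signed.∣m∣n⇒∣m+n even (Signed.divides b refl))
  where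
  shifted : ∀ a b → (+ 0 * a - + 1 * b) + (+ 0 * b + + 1 * a) + b * + 2 ≡ a + b
  shifted = solve-∀
even-coordSum-unit* negeye a b even = subst Even (shifted a b) (Signed.∣m∣n⇒∣m+n even (Signed.divides a refl))
  where
  shifted : ∀ a b → (+ 0 * a - - + 1 * b) + (+ 0 * b + - + 1 * a) + a * + 2 ≡ a + b
  shifted = solve-∀

w<w[1+n] : ∀ n → w n ℕ.< w (suc n)
w<w[1+n] zero          = ℕ.≤-refl
w<w[1+n] (suc zero)    = ℕ.n≤1+n 5
w<w[1+n] (suc (suc n)) = ℕ.*-monoʳ-< 2 (w<w[1+n] n)

2+w[1+n]≤w[2+n] : ∀ n → 2 ℕ.+ w (suc n) ℕ.≤ w (suc (suc n))
2+w[1+n]≤w[2+n] zero    = ℕ.≤-refl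
2+w[1+n]≤w[2+n] (suc n) = subst (ℕ._≤ 2 ℕ.* w (suc n)) (ℕ.*-suc 2 (w n)) (ℕ.*-monoʳ-≤ 2 (w<w[1+n] n))

4≤w[1+n] : ∀ n → 4 ℕ.≤ w (suc n)
4≤w[1+n] zero    = ℕ.≤-refl
4≤w[1+n] (suc n) = ℕ.≤-trans (ℕ.m≤n⇒m≤o+n 2 (4≤w[1+n] n)) (2+w[1+n]≤w[2+n] n)

2∣w[1+n] : ∀ n → 2 ℕᵈ.∣ w (suc n)
2∣w[1+n] zero    = ℕᵈ.divides 2 refl
2∣w[1+n] (suc n) = ℕᵈ.m∣m*n (w n)

i+[j-i]≡j : ∀ i j → i + (j - i) ≡ j
i+[j-i]≡j = solve-∀

i+j-i≡j : ∀ i j → i + j - i ≡ j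
i+j-i≡j = solve-∀

+a≤+b-+c⇒c+a≤b : ∀ {a b c} → + a ≤ + b - + c → c ℕ.+ a ℕ.≤ b
+a≤+b-+c⇒c+a≤b {a} {b} {c} h = ℤ.drop‿+≤+ (subst (+ (c ℕ.+ a) ≤_) (i+[j-i]≡j (+ c) (+ b)) (ℤ.+-monoʳ-≤ (+ c) h))

c+a≤b⇒+a≤+b-+c : ∀ {a b c} → c ℕ.+ a ℕ.≤ b → + a ≤ + b - + c
c+a≤b⇒+a≤+b-+c {a} {b} {c} h = subst (_≤ + b - + c) (i+j-i≡j (+ c) (+ a)) (ℤ.+-monoˡ-≤ (- + c) (+≤+ h))

∣i∣+∣j∣≡∣i-j∣⊎∣i+j∣ : ∀ i j → ∣ i ∣ ℕ.+ ∣ j ∣ ≡ ∣ i - j ∣ ⊎ ∣ i ∣ ℕ.+ ∣ j ∣ ≡ ∣ i + j ∣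
∣i∣+∣j∣≡∣i-j∣⊎∣i+j∣ (+ m)    (+ n)          = inj₂ refl
∣i∣+∣j∣≡∣i-j∣⊎∣i+j∣ (+ m)    -[1+ n ]       = inj₁ refl
∣i∣+∣j∣≡∣i-j∣⊎∣i+j∣ -[1+ m ] (+ zero)       = inj₂ (ℕ.+-identityʳ (suc m))
∣i∣+∣j∣≡∣i-j∣⊎∣i+j∣ -[1+ m ] (+ suc n)      = inj₁ (cong suc (ℕ.+-suc m n))
∣i∣+∣j∣≡∣i-j∣⊎∣i+j∣ -[1+ m ] -[1+ n ]       = inj₂ (cong suc (ℕ.+-suc m n))

-- One step towards 0; 0 itself steps to -1.
stepToZero : ℤ → ℤ
stepToZero i = i - (sign i ◃ 1)

∣stepToZero∣ : ∀ i → suc ∣ stepToZero i ∣ ≡ ∣ i ∣ ⊎ ∣ stepToZero i ∣ ≡ 1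
∣stepToZero∣ (+ zero)     = inj₂ refl
∣stepToZero∣ (+ suc n)    = inj₁ refl
∣stepToZero∣ -[1+ zero ]  = inj₁ refl
∣stepToZero∣ -[1+ suc n ] = inj₁ refl

half-bound : ∀ {a s W} → 2 ℕ.* a ℕ.≤ s → 4 ℕ.+ s ℕ.≤ 2 ℕ.* W → 2 ℕ.+ a ℕ.≤ W
half-bound {a} {s} {W} 2a≤s 4+s≤2W = ℕ.*-cancelˡ-≤ 2
  (subst (ℕ._≤ 2 ℕ.* W) (sym (ℕ.*-distribˡ-+ 2 2 a)) (ℕ.≤-trans (ℕ.+-monoʳ-≤ 4 2a≤s) 4+s≤2W))

OctDiag : ℕ → ℕ → ℕ → Set
OctDiag m a b = 3 ℕ.+ a ℕ.≤ w (suc m) × 3 ℕ.+ b ℕ.≤ w (suc m) × 4 ℕ.+ (a ℕ.+ b) ℕ.≤ w (suc (suc m))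

OctDiag-comm : ∀ m {a b} → OctDiag m a b → OctDiag m b a
OctDiag-comm m {a} {b} (a≤ , b≤ , a+b≤) = b≤ , a≤ , subst (λ k → 4 ℕ.+ k ℕ.≤ w (suc (suc m))) (ℕ.+-comm a b) a+b≤

OctDiag⇒Oct : ∀ m x y → OctDiag m ∣ x - y ∣ ∣ x + y ∣ → Oct m (x , y)
OctDiag⇒Oct m x y (x-y≤ , x+y≤ , sum≤) =
  c+a≤b⇒+a≤+b-+c (half-bound {W = w m} 2∣x∣≤ sum≤) ,
  c+a≤b⇒+a≤+b-+c (half-bound {W = w m} 2∣y∣≤ sum≤) ,
  c+a≤b⇒+a≤+b-+c ∣x∣+∣y∣≤
  where
  double-x : ∀ x y → (x - y) + (x + y) ≡ + 2 * x
  double-x = solve-∀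
  double-y : ∀ x y → (x + y) - (x - y) ≡ + 2 * y
  double-y = solve-∀
  2∣x∣≤ : 2 ℕ.* ∣ x ∣ ℕ.≤ ∣ x - y ∣ ℕ.+ ∣ x + y ∣
  2∣x∣≤ = subst (ℕ._≤ ∣ x - y ∣ ℕ.+ ∣ x + y ∣) (trans (cong ∣_∣ (double-x x y)) (ℤ.abs-* (+ 2) x))
            (ℤ.∣i+j∣≤∣i∣+∣j∣ (x - y) (x + y))
  2∣y∣≤ : 2 ℕ.* ∣ y ∣ ℕ.≤ ∣ x - y ∣ ℕ.+ ∣ x + y ∣
  2∣y∣≤ = subst₂ ℕ._≤_ (trans (cong ∣_∣ (double-y x y)) (ℤ.abs-* (+ 2) y)) (ℕ.+-comm ∣ x + y ∣ ∣ x - y ∣)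
            (ℤ.∣i-j∣≤∣i∣+∣j∣ (x + y) (x - y))
  ∣x∣+∣y∣≤ : 3 ℕ.+ (∣ x ∣ ℕ.+ ∣ y ∣) ℕ.≤ w (suc m)
  ∣x∣+∣y∣≤ with ∣i∣+∣j∣≡∣i-j∣⊎∣i+j∣ x y
  ... | inj₁ eq = subst (λ k → 3 ℕ.+ k ℕ.≤ w (suc m)) (sym eq) x-y≤
  ... | inj₂ eq = subst (λ k → 3 ℕ.+ k ℕ.≤ w (suc m)) (sym eq) x+y≤

-- w (m+1) - 2 is even, so an odd o cannot reach it.
odd⇒3+o≤w[1+n] : ∀ m {o} → ¬ 2 ℕᵈ.∣ o → 2 ℕ.+ o ℕ.≤ w (suc m) → 3 ℕ.+ o ℕ.≤ w (suc m)
odd⇒3+o≤w[1+n] m odd o≤ = ℕ.≤∧≢⇒< o≤ λ eq →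
  odd (ℕᵈ.∣m+n∣m⇒∣n (subst (2 ℕᵈ.∣_) (sym eq) (2∣w[1+n] m)) ℕᵈ.∣-refl)

step-OctDiag : ∀ m {o e e′} → ¬ 2 ℕᵈ.∣ o
  → 2 ℕ.+ o ℕ.≤ w (suc m) → 2 ℕ.+ e ℕ.≤ w (suc m) → 3 ℕ.+ (o ℕ.+ e) ℕ.≤ w (suc (suc m))
  → suc e′ ≡ e ⊎ e′ ≡ 1 → OctDiag m o e′
step-OctDiag m {o} {e′ = e′} odd o≤ e≤ o+e≤ (inj₁ refl) =
  odd⇒3+o≤w[1+n] m odd o≤ , e≤ , subst (λ k → 3 ℕ.+ k ℕ.≤ w (suc (suc m))) (ℕ.+-suc o e′) o+e≤
step-OctDiag m {o} odd o≤ e≤ o+e≤ (inj₂ refl) =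
  odd⇒3+o≤w[1+n] m odd o≤ , 4≤w[1+n] m ,
  subst (ℕ._≤ w (suc (suc m))) (cong (4 ℕ.+_) (ℕ.+-comm 1 o))
    (ℕ.≤-trans (ℕ.+-monoʳ-≤ 2 (odd⇒3+o≤w[1+n] m odd o≤)) (2+w[1+n]≤w[2+n] m))

Oct-swap : ∀ m {x y} → Oct m (x , y) → Oct m (y , x)
Oct-swap m {x} {y} (x≤ , y≤ , x+y≤) = y≤ , x≤ , subst (_≤ + w (suc m) - + 3) (ℤ.+-comm (+ ∣ x ∣) (+ ∣ y ∣)) x+y≤

Oct-suc⇒OctDiag : ∀ m {p q} → Oct (suc m) (p , q) → Odd p → OctDiag m ∣ p ∣ ∣ stepToZero q ∣
Oct-suc⇒OctDiag m {q = q} (p≤ , q≤ , p+q≤) odd-p =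
  step-OctDiag m (odd-p ∘ Signed.∣ᵤ⇒∣) (+a≤+b-+c⇒c+a≤b p≤) (+a≤+b-+c⇒c+a≤b q≤) (+a≤+b-+c⇒c+a≤b p+q≤)
    (∣stepToZero∣ q)

OddOct⊆B : ℕ → Set
OddOct⊆B m = ∀ {t} → Oct m t → Odd (coordSum t) → B m t

oddOct₀⊆B : OddOct⊆B 0
oddOct₀⊆B {+ suc (suc _) , _}         (+≤+ (s≤s ()) , _)     _
oddOct₀⊆B { -[1+ suc _ ] , _}          (+≤+ (s≤s ()) , _)     _
oddOct₀⊆B {_ , + suc (suc _)}         (_ , +≤+ (s≤s ()) , _) _
oddOct₀⊆B {_ , -[1+ suc _ ]}          (_ , +≤+ (s≤s ()) , _) _
oddOct₀⊆B {+ 0 , + 0}                 _ odd = contradiction (Signed.divides (+ 0) refl) odd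
oddOct₀⊆B {+ 1 , + 0}                 _ _ = unit∈B₀ one
oddOct₀⊆B { -[1+ 0 ] , + 0}            _ _ = unit∈B₀ negone
oddOct₀⊆B {+ 0 , + 1}                 _ _ = unit∈B₀ eye
oddOct₀⊆B {+ 0 , -[1+ 0 ]}            _ _ = unit∈B₀ negeye
oddOct₀⊆B {+ 1 , + 1}                 (_ , _ , +≤+ (s≤s ())) _
oddOct₀⊆B {+ 1 , -[1+ 0 ]}            (_ , _ , +≤+ (s≤s ())) _
oddOct₀⊆B { -[1+ 0 ] , + 1}            (_ , _ , +≤+ (s≤s ())) _
oddOct₀⊆B { -[1+ 0 ] , -[1+ 0 ]}       (_ , _ , +≤+ (s≤s ())) _

B-suc-unit+ᵍ : ∀ m → OddOct⊆B m → ∀ u {P Q} → Even (P + Q) → Odd Q → OctDiag m ∣ P ∣ ∣ Q ∣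
  → B (suc m) (unitVal u +ᵍ (P , Q))
B-suc-unit+ᵍ m ih u {P} {Q} even-P+Q odd-Q diag with even-coordSum⇒ρ∣ᵍ even-P+Q
... | (x , y) , PQ≡ρt =
  subst (λ z → B (suc m) (unitVal u +ᵍ z)) (sym PQ≡ρt) (B-suc m (dunit u) (ih {x , y} t∈Oct odd-t))
  where
  P≡x-y : P ≡ x - y
  P≡x-y = trans (cong re PQ≡ρt) (cong₂ _-_ (ℤ.*-identityˡ x) (ℤ.*-identityˡ y))
  Q≡x+y : Q ≡ x + y
  Q≡x+y = trans (cong im PQ≡ρt) (trans (cong₂ _+_ (ℤ.*-identityˡ y) (ℤ.*-identityˡ x)) (ℤ.+-comm y x))
  t∈Oct : Oct m (x , y)
  t∈Oct = OctDiag⇒Oct m x y (subst₂ (λ i j → OctDiag m ∣ i ∣ ∣ j ∣) P≡x-y Q≡x+y diag)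
  odd-t : Odd (x + y)
  odd-t = subst Odd Q≡x+y odd-Q

realUnit imagUnit : Sign → Unit
realUnit Sign.+ = one
realUnit Sign.- = negone
imagUnit Sign.+ = eye
imagUnit Sign.- = negeye

realUnit-undoes-step : ∀ p q → unitVal (realUnit (sign p)) +ᵍ (stepToZero p , q) ≡ (p , q)
realUnit-undoes-step p@(+ _)    q = cong₂ _,_ (i+[j-i]≡j (+ 1) p) (ℤ.+-identityˡ q)
realUnit-undoes-step p@(-[1+ _ ]) q = cong₂ _,_ (i+[j-i]≡j (- + 1) p) (ℤ.+-identityˡ q)

imagUnit-undoes-step : ∀ p q → unitVal (imagUnit (sign q)) +ᵍ (p , stepToZero q) ≡ (p , q)
imagUnit-undoes-step p q@(+ _)    = cong₂ _,_ (ℤ.+-identityˡ p) (i+[j-i]≡j (+ 1) q)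
imagUnit-undoes-step p q@(-[1+ _ ]) = cong₂ _,_ (ℤ.+-identityˡ p) (i+[j-i]≡j (- + 1) q)

B-suc-odd-even : ∀ m → OddOct⊆B m → ∀ {p q} → Oct (suc m) (p , q) → Odd (p + q) → Odd p → Even q
  → B (suc m) (p , q)
B-suc-odd-even m ih {p} {q} oct odd-p+q odd-p even-q =
  subst (B (suc m)) (imagUnit-undoes-step p q)
    (B-suc-unit+ᵍ m ih (imagUnit (sign q)) even-P+Q (even-odd⇒odd even-q (odd[s◃1] (sign q)))
      (Oct-suc⇒OctDiag m {p} {q} oct odd-p))
  where
  even-P+Q : Even (p + stepToZero q)
  even-P+Q = subst Even (ℤ.+-assoc p q (- (sign q ◃ 1))) (odd⇒even[i-s◃1] (sign q) odd-p+q)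

B-suc-even-odd : ∀ m → OddOct⊆B m → ∀ {p q} → Oct (suc m) (p , q) → Odd (p + q) → Even p → Odd q
  → B (suc m) (p , q)
B-suc-even-odd m ih {p} {q} oct odd-p+q even-p odd-q =
  subst (B (suc m)) (realUnit-undoes-step p q)
    (B-suc-unit+ᵍ m ih (realUnit (sign p)) even-P+Q odd-q
      (OctDiag-comm m (Oct-suc⇒OctDiag m {q} {p} (Oct-swap (suc m) {p} {q} oct) odd-q)))
  where
  regroup : ∀ p q s → p + q - s ≡ p - s + q
  regroup = solve-∀
  even-P+Q : Even (stepToZero p + q)
  even-P+Q = subst Even (regroup p q (sign p ◃ 1)) (odd⇒even[i-s◃1] (sign p) odd-p+q)

oddOct⊆B : ∀ n → OddOct⊆B n
oddOct⊆B zero = oddOct₀⊆B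
oddOct⊆B (suc m) {p , q} oct odd-p+q with + 2 Signed.∣? p | + 2 Signed.∣? q
... | yes even-p | yes even-q = contradiction (Signed.∣m∣n⇒∣m+n even-p even-q) odd-p+q
... | no odd-p   | no odd-q   = contradiction (odd+odd⇒even odd-p odd-q) odd-p+q
... | no odd-p   | yes even-q = B-suc-odd-even m (oddOct⊆B m) oct odd-p+q odd-p even-q
... | yes even-p | no odd-q   = B-suc-even-odd m (oddOct⊆B m) oct odd-p+q even-p odd-q

lemma3p1 : (n : ℕ) (a b : ℤ) → ¬ (ρ ∣ᵍ (a , b)) → (u : Unit) → (x y : ℤ)
    → (x , y) ∈ Oct n +ₛ (unitVal u *ᵍ (a , b))
    → Data.Integer.+ 2 ∣ (x + y)
    → (x , y) ∈ B n +ₛ (unitVal u *ᵍ (a , b))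
lemma3p1 n a b ρ∤a+bi u x y (s , s∈Oct , xy≡s+c) 2∣x+y = s , oddOct⊆B n s∈Oct odd-s , xy≡s+c
  where
  c : ℤ[i]
  c = unitVal u *ᵍ (a , b)
  odd-c : Odd (coordSum c)
  odd-c = ρ∤a+bi ∘ even-coordSum⇒ρ∣ᵍ ∘ even-coordSum-unit* u a b
  even-s+c : Even (coordSum s + coordSum c)
  even-s+c = subst Even (trans (cong coordSum xy≡s+c) (coordSum-+ᵍ s c)) (Signed.∣ᵤ⇒∣ 2∣x+y)
  odd-s : Odd (coordSum s)
  odd-s even-s = odd-c (Signed.∣m+n∣m⇒∣n even-s+c even-s)
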